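{- Let $n\ge 2$, let $d$ be a non-negative integer, and let $C$ be an $n\times n$ circulant matrix with generator $(c_0,\ldots,c_{n-1})$ such that $c_0=d$, $c_j\in\{1,-1\}$ for $j=1,\ldots,n-1$, and $CC^T=(d^2+n-1)I$. Then $n=k(2d+k)+1$ for some positive integer $k$.
   Context: A circulant matrix of order $n$ with generator $(c_0,c_1,\ldots,c_{n-1})$ is the $n\times n$ matrix whose entry in row $i$ and column $j$ (indices $0,\ldots,n-1$) is $c_{(j-i)\bmod n}$. -}

module Defs where

open import Data.Nat using (ℕ; zero; suc; _%_; _+_; NonZero)
open import Data.Fin using (Fin; toℕ; fromℕ<)
open import Data.Nat.DivMod using (m%n<n)
open import Data.Integer using (ℤ; +_; _*_) renaming (_+_ to _+ℤ_)
open import Data.Nat.Properties using (m+n∸m≡n)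
open import Relation.Binary.PropositionalEquality using (_≡_)
import Relation.Nullary

Matrix : ℕ → Set
Matrix n = Fin n → Fin n → ℤ

Σ : ∀ {n} → (Fin n → ℤ) → ℤ
Σ {zero} f = + 0
Σ {suc n} f = f Data.Fin.zero +ℤ Σ (λ i → f (Data.Fin.suc i))

-- (j - i) mod n, computed as (j + (n - i)) mod n on naturals.
subMod : ∀ {n} → Fin n → Fin n → Fin n
subMod {zero} () _
subMod {suc n} j i =
  fromℕ< (m%n<n (toℕ j + (suc n Data.Nat.∸ toℕ i)) (suc n))

circulant : ∀ {n} → (Fin n → ℤ) → Matrix n
circulant c i j = c (subMod j i)

transpose : ∀ {n} → Matrix n → Matrix n
transpose A i j = A j i

_·_ : ∀ {n} → Matrix n → Matrix n → Matrix n
(A · B) i j = Σ (λ k → A i k * B k j)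

scalarI : ∀ {n} → ℤ → Matrix n
scalarI {n} s i j with i Data.Fin.≟ j
... | Relation.Nullary.yes _ = s
... | Relation.Nullary.no _ = + 0

-- Every column of a circulant matrix C sums to s = c₀ + ⋯ + c_{n-1}, so every row of
-- C Cᵀ sums to s². Comparing with a row of (d² + n − 1) I gives s² = d² + (n − 1), and since
-- n − 1 > 0 this forces |s| > d; with k = |s| − d we get n − 1 = (k + d)² − d² = k (2d + k).
module Submission where

open import Defs
open import Data.Nat using (ℕ; suc; zero; _+_; _*_; _≤_; _^_)
open import Data.Fin using (Fin; toℕ)
open import Data.Integer using (ℤ; +_; -_)
open import Data.Sum using (_⊎_)
open import Data.Product using (Σ-syntax; _×_)
open import Relation.Binary.PropositionalEquality using (_≡_; _≢_)

open import Data.Product using (_,_)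
open import Relation.Binary.PropositionalEquality
  using (refl; sym; trans; cong; cong₂; subst; _≗_; module ≡-Reasoning)
open import Function using (_∘_)
open import Relation.Nullary using (yes; no; contradiction)
open import Data.Nat using (_∸_; _<_; NonZero; s≤s; z≤n)
open import Data.Nat.Properties
  using (+-cancelʳ-≡; m∸n+n≡m; m<m+n; <⇒≤; <⇒≱; ≰⇒>; *-mono-≤; m<n⇒0<n∸m; +-comm; _≤?_)
open import Data.Nat.DivMod using (_%_; _/_; m%n<n; m≡m%n+[m/n]*n; [m+kn]%n≡m%n; [m+n]%n≡m%n; m<n⇒m%n≡m)
import Data.Nat.Tactic.RingSolver as ℕ-Solver
import Data.Fin as Fin
open import Data.Fin using (_≟_; punchIn)
open import Data.Fin.Properties using (toℕ-injective; toℕ-fromℕ<; toℕ<n; punchInᵢ≢i)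
open import Data.Fin.Permutation using (permutation)
open import Data.Integer using (∣_∣) renaming (_+_ to _+ℤ_; _*_ to _*ℤ_)
open import Data.Integer.Properties using (+-*-semiring; abs-*; +-identityʳ)
open import Algebra.Properties.Semiring.Sum +-*-semiring
  using (sum; sum-cong-≗; ∑-comm; *-distribˡ-sum; *-distribʳ-sum; sum-permute; sum-remove; sum-replicate-zero)

Σ≡sum : ∀ {n} (f : Fin n → ℤ) → Σ f ≡ sum f
Σ≡sum {zero}  f = refl
Σ≡sum {suc n} f = cong (f Fin.zero +ℤ_) (Σ≡sum (f ∘ Fin.suc))

sum-involution : ∀ {n} (f : Fin n → ℤ) (p : Fin n → Fin n) → (∀ i → p (p i) ≡ i) →
                 sum (f ∘ p) ≡ sum f
sum-involution f p p∘p≗id = sym (sum-permute f (permutation p p p∘p≗id p∘p≗id))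

sum-zeros : ∀ {n} {f : Fin n → ℤ} → (∀ i → f i ≡ + 0) → sum f ≡ + 0
sum-zeros {n} f≗0 = trans (sum-cong-≗ f≗0) (sum-replicate-zero n)

rowSum-· : ∀ {n} (A B : Matrix n) i →
           sum ((A · B) i) ≡ sum (λ k → A i k *ℤ sum (B k))
rowSum-· A B i = begin
  sum (λ j → Σ (λ k → A i k *ℤ B k j))        ≡⟨ sum-cong-≗ (λ j → Σ≡sum (λ k → A i k *ℤ B k j)) ⟩
  sum (λ j → sum (λ k → A i k *ℤ B k j))      ≡⟨ ∑-comm (λ j k → A i k *ℤ B k j) ⟩
  sum (λ k → sum (λ j → A i k *ℤ B k j))      ≡⟨ sum-cong-≗ (λ k → sym (*-distribˡ-sum (A i k) (B k))) ⟩
  sum (λ k → A i k *ℤ sum (B k))              ∎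
  where open ≡-Reasoning

scalarI-diagonal : ∀ {n} (s : ℤ) (i : Fin n) → scalarI s i i ≡ s
scalarI-diagonal s i with i ≟ i
... | yes _   = refl
... | no i≢i = contradiction refl i≢i

scalarI-offDiagonal : ∀ {n} (s : ℤ) {i j : Fin n} → i ≢ j → scalarI s i j ≡ + 0
scalarI-offDiagonal s {i} {j} i≢j with i ≟ j
... | yes i≡j = contradiction i≡j i≢j
... | no _    = refl

rowSum-scalarI : ∀ {n} (s : ℤ) (i : Fin (suc n)) → sum (scalarI s i) ≡ s
rowSum-scalarI s i = begin
  sum (scalarI s i)                                      ≡⟨ sum-remove {i = i} (scalarI s i) ⟩
  scalarI s i i +ℤ sum (scalarI s i ∘ punchIn i)
    ≡⟨ cong₂ _+ℤ_ (scalarI-diagonal s i) (sum-zeros (λ j → scalarI-offDiagonal s (punchInᵢ≢i i j ∘ sym))) ⟩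
  s +ℤ + 0                                               ≡⟨ +-identityʳ s ⟩
  s                                                      ∎
  where open ≡-Reasoning

-- Adding y = k + (n ∸ i) = x + q n to both sides turns the congruence k + (n ∸ x) ≡ i (mod n)
-- into an exact equation of naturals, which avoids cancelling x modulo n.
[k+[n∸[k+[n∸i]]%n]]%n≡i : ∀ {n} .{{_ : NonZero n}} k {i} → i < n →
                          (k + (n ∸ (k + (n ∸ i)) % n)) % n ≡ i
[k+[n∸[k+[n∸i]]%n]]%n≡i {n} k {i} i<n = begin
  (k + (n ∸ x)) % n      ≡⟨ cong (_% n) (+-cancelʳ-≡ y _ _ shifted) ⟩
  (i + q * n) % n        ≡⟨ [m+kn]%n≡m%n i q n ⟩
  i % n                  ≡⟨ m<n⇒m%n≡m i<n ⟩
  i                      ∎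
  where
  open ≡-Reasoning
  y = k + (n ∸ i)
  x = y % n
  q = y / n
  regroupˡ : ∀ a b c d → (a + b) + (c + d) ≡ a + (b + c) + d
  regroupˡ = ℕ-Solver.solve-∀
  regroupʳ : ∀ a b c d → a + (b + c) + d ≡ (c + d) + (a + b)
  regroupʳ = ℕ-Solver.solve-∀
  shifted : (k + (n ∸ x)) + y ≡ (i + q * n) + y
  shifted = begin
    (k + (n ∸ x)) + y                ≡⟨ cong (λ t → (k + (n ∸ x)) + t) (m≡m%n+[m/n]*n y n) ⟩
    (k + (n ∸ x)) + (x + q * n)      ≡⟨ regroupˡ k (n ∸ x) x (q * n) ⟩
    k + ((n ∸ x) + x) + q * n        ≡⟨ cong (λ t → k + t + q * n) (m∸n+n≡m (<⇒≤ (m%n<n y n))) ⟩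
    k + n + q * n                    ≡⟨ cong (λ t → k + t + q * n) (sym (m∸n+n≡m (<⇒≤ i<n))) ⟩
    k + ((n ∸ i) + i) + q * n        ≡⟨ regroupʳ k (n ∸ i) i (q * n) ⟩
    (i + q * n) + y                  ∎

toℕ-subMod : ∀ {n} (j i : Fin (suc n)) → toℕ (subMod j i) ≡ (toℕ j + (suc n ∸ toℕ i)) % suc n
toℕ-subMod j i = toℕ-fromℕ< _

subMod-identityʳ : ∀ {n} (j : Fin (suc n)) → subMod j Fin.zero ≡ j
subMod-identityʳ {n} j = toℕ-injective (begin
  toℕ (subMod j Fin.zero)           ≡⟨ toℕ-subMod j Fin.zero ⟩
  (toℕ j + suc n) % suc n           ≡⟨ [m+n]%n≡m%n (toℕ j) (suc n) ⟩
  toℕ j % suc n                     ≡⟨ m<n⇒m%n≡m (toℕ<n j) ⟩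
  toℕ j                             ∎)
  where open ≡-Reasoning

subMod-involutive : ∀ {n} (j i : Fin n) → subMod j (subMod j i) ≡ i
subMod-involutive {suc n} j i = toℕ-injective (begin
  toℕ (subMod j (subMod j i))                                        ≡⟨ toℕ-subMod j (subMod j i) ⟩
  (toℕ j + (suc n ∸ toℕ (subMod j i))) % suc n
    ≡⟨ cong (λ t → (toℕ j + (suc n ∸ t)) % suc n) (toℕ-subMod j i) ⟩
  (toℕ j + (suc n ∸ (toℕ j + (suc n ∸ toℕ i)) % suc n)) % suc n      ≡⟨ [k+[n∸[k+[n∸i]]%n]]%n≡i (toℕ j) (toℕ<n i) ⟩
  toℕ i                                                              ∎)
  where open ≡-Reasoning

circulant-colSum : ∀ {n} (c : Fin n → ℤ) k → sum (λ j → circulant c j k) ≡ sum c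
circulant-colSum c k = sum-involution c (subMod k) (subMod-involutive k)

circulant-row₀ : ∀ {n} (c : Fin (suc n) → ℤ) → circulant c Fin.zero ≗ c
circulant-row₀ c k = cong c (subMod-identityʳ k)

rowSum-·-circulantᵀ : ∀ {n} (A : Matrix n) (c : Fin n → ℤ) i →
                      sum ((A · transpose (circulant c)) i) ≡ sum (A i) *ℤ sum c
rowSum-·-circulantᵀ A c i = begin
  sum ((A · transpose (circulant c)) i)                      ≡⟨ rowSum-· A (transpose (circulant c)) i ⟩
  sum (λ k → A i k *ℤ sum (λ j → circulant c j k))          ≡⟨ sum-cong-≗ (λ k → cong (A i k *ℤ_) (circulant-colSum c k)) ⟩
  sum (λ k → A i k *ℤ sum c)                                 ≡⟨ sym (*-distribʳ-sum (sum c) (A i)) ⟩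
  sum (A i) *ℤ sum c                                         ∎
  where open ≡-Reasoning

circulant-Gram-rowSum₀ : ∀ {n} (c : Fin (suc n) → ℤ) →
                         sum ((circulant c · transpose (circulant c)) Fin.zero) ≡ sum c *ℤ sum c
circulant-Gram-rowSum₀ c = trans (rowSum-·-circulantᵀ (circulant c) c Fin.zero)
                                 (cong (_*ℤ sum c) (sum-cong-≗ (circulant-row₀ c)))

circulant-Gram≡scalarI⇒sum²≡ : ∀ {n} (c : Fin (suc n) → ℤ) (s : ℤ) →
                               (circulant c · transpose (circulant c)) Fin.zero ≗ scalarI s Fin.zero →
                               sum c *ℤ sum c ≡ s
circulant-Gram≡scalarI⇒sum²≡ {n} c s row₀≡ = begin
  sum c *ℤ sum c                                          ≡⟨ circulant-Gram-rowSum₀ c ⟨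
  sum ((circulant c · transpose (circulant c)) Fin.zero)  ≡⟨ sum-cong-≗ {suc n} row₀≡ ⟩
  sum (scalarI {suc n} s Fin.zero)                        ≡⟨ rowSum-scalarI {n} s Fin.zero ⟩
  s                                                       ∎
  where open ≡-Reasoning

square-gap : ∀ a d m → 0 < m → a * a ≡ d * d + m → Σ[ k ∈ ℕ ] ((1 ≤ k) × (m ≡ k * (2 * d + k)))
square-gap a d m 0<m a²≡d²+m with a ≤? d
... | yes a≤d = contradiction (subst (_≤ d * d) a²≡d²+m (*-mono-≤ a≤d a≤d)) (<⇒≱ (m<m+n (d * d) 0<m))
... | no a≰d  = k , m<n⇒0<n∸m d<a , +-cancelʳ-≡ (d * d) _ _ (begin
  m + d * d                  ≡⟨ +-comm (d * d) m ⟨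
  d * d + m                  ≡⟨ a²≡d²+m ⟨
  a * a                      ≡⟨ cong (λ t → t * t) (m∸n+n≡m (<⇒≤ d<a)) ⟨
  (k + d) * (k + d)          ≡⟨ expand k d ⟩
  k * (2 * d + k) + d * d    ∎)
  where
  open ≡-Reasoning
  d<a = ≰⇒> a≰d
  k = a ∸ d
  expand : ∀ k d → (k + d) * (k + d) ≡ k * (2 * d + k) + d * d
  expand = ℕ-Solver.solve-∀

proposition3p3 : (n : ℕ) → 2 ≤ n → (d : ℕ) → (c : Fin n → ℤ)
    → ((i : Fin n) → toℕ i ≡ 0 → c i ≡ + d)
    → ((j : Fin n) → toℕ j ≢ 0 → (c j ≡ + 1) ⊎ (c j ≡ - (+ 1)))
    → ((i j : Fin n) → (circulant c · transpose (circulant c)) i j ≡ scalarI (+ (d * d + (n Data.Nat.∸ 1))) i j)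
    → Σ[ k ∈ ℕ ] ((1 ≤ k) × (n ≡ k * (2 * d + k) + 1))
proposition3p3 (suc (suc m)) (s≤s (s≤s z≤n)) d c _ _ CCᵀ≡dI =
  let k , 1≤k , n-1≡k[2d+k] = square-gap ∣ s ∣ d (suc m) (s≤s z≤n) ∣s∣²≡d²+n-1
  in  k , 1≤k , trans (cong suc n-1≡k[2d+k]) (+-comm 1 _)
  where
  s = sum c
  ∣s∣²≡d²+n-1 : ∣ s ∣ * ∣ s ∣ ≡ d * d + suc m
  ∣s∣²≡d²+n-1 = trans (sym (abs-* s s)) (cong ∣_∣ (circulant-Gram≡scalarI⇒sum²≡ c _ (CCᵀ≡dI Fin.zero)))
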